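{- Let $\mathbf{L}\in\{\mathbf{K},\mathbf{T},\mathbf{K4},\mathbf{S4}\}$. Then (1) $\mathbf{L}^{Horn}$ is strongly less expressive than $\mathbf{L}^{Bool}$, and (2) $\mathbf{L}^{Core}$ is strongly less expressive than $\mathbf{L}^{Krom}$.
   Context: Fix a countable set $\mathcal P$ of propositional letters. Modal formulas are generated by $\varphi ::= \top \mid p \mid \neg\varphi \mid \varphi\vee\varphi \mid \Diamond\varphi \mid \Box\varphi$ with $p\in\mathcal P$; $\wedge,\rightarrow$ are abbreviations and $\bot:=\neg\top$. A Kripke model is $M=(W,R,V)$ with $W\neq\emptyset$, $R\subseteq W\times W$, $V:W\to 2^{\mathcal P}$, with the standard satisfaction relation ($M,w\models\Diamond\psi$ iff $M,v\models\psi$ for some $v$ with $wRv$; $M,w\models\Box\psi$ iff $M,v\models\psi$ for all $v$ with $wRv$). The logics $\mathbf{K},\mathbf{T},\mathbf{K4},\mathbf{S4}$ are interpreted over, respectively, all frames, reflexive frames, transitive frames, reflexive and transitive frames. Positive literals are generated by $\lambda ::= \top \mid p \mid \Diamond\lambda \mid \Box\lambda$. A clause is a formula $\Box^s(\neg\lambda_1\vee\dots\vee\neg\lambda_n\vee\lambda_{n+1}\vee\dots\vee\lambda_{n+m})$ with $s,n,m\ge 0$ ($\Box^s$ denotes $s$ nested boxes) and $\lambda_i$ positive literals; a formula in clausal form is a finite conjunction of clauses (literals $\lambda$, $\neg\lambda$ count as clauses). $\mathbf{L}^{Bool}$ is the full modal language interpreted over the frame class of $\mathbf{L}$; $\mathbf{L}^{Horn}$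 consists of clausal-form formulas whose clauses all have $m\le 1$; $\mathbf{L}^{Krom}$ of those whose clauses all have $n+m\le 2$; $\mathbf{L}^{Core}$ of those satisfying both restrictions; all interpreted over the frame class of $\mathbf{L}$. For two such languages $\mathcal L_1,\mathcal L_2$ over the same frame class $\mathcal C$: a model-extending translation from $\mathcal L_1$ to $\mathcal L_2$ is an effective map sending each $\mathcal L_1$-formula $\varphi$ over an alphabet $\mathcal P_0$ to an $\mathcal L_2$-formula $\varphi'$ over an alphabet $\mathcal P'\supseteq\mathcal P_0$ such that for every model $M$ over a frame in $\mathcal C$ and every world $w$, $M,w\models\varphi$ iff the valuation of $M$ can be extended to $\mathcal P'$ giving a model $M'$ with $M',w\models\varphi'$. $\mathcal L_1$ is strongly less expressive than $\mathcal L_2$ if there is a model-extending translation from $\mathcal L_1$ to $\mathcal L_2$ but none from $\mathcal L_2$ to $\mathcal L_1$. -}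

module Defs where

open import Data.Nat using (ℕ; _+_; _≤_)
open import Data.List using (List; []; _∷_; map; _++_; length)
open import Data.List.Relation.Unary.All using (All)
open import Data.Product using (Σ; _×_; _,_)
open import Data.Sum using (_⊎_)
open import Data.Empty using (⊥)
open import Data.Unit using (tt) renaming (⊤ to Unit)
open import Relation.Nullary using (¬_)
open import Relation.Binary.PropositionalEquality using (_≡_)
open import Function.Bundles using (_⇔_)

data Fm : Set where
  ⊤ᶠ  : Fm
  var : ℕ → Fm
  ¬ᶠ_ : Fm → Fm
  _∨ᶠ_ : Fm → Fm → Fm
  ◇_  : Fm → Fm
  □_  : Fm → Fm

infixr 6 _∨ᶠ_

⊥ᶠ : Fm
⊥ᶠ = ¬ᶠ ⊤ᶠ

_∧ᶠ_ : Fm → Fm → Fm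
φ ∧ᶠ ψ = ¬ᶠ ((¬ᶠ φ) ∨ᶠ (¬ᶠ ψ))

_→ᶠ_ : Fm → Fm → Fm
φ →ᶠ ψ = (¬ᶠ φ) ∨ᶠ ψ

data Occurs (p : ℕ) : Fm → Set where
  here : Occurs p (var p)
  ¬o   : ∀ {φ} → Occurs p φ → Occurs p (¬ᶠ φ)
  ∨l   : ∀ {φ ψ} → Occurs p φ → Occurs p (φ ∨ᶠ ψ)
  ∨r   : ∀ {φ ψ} → Occurs p ψ → Occurs p (φ ∨ᶠ ψ)
  ◇o   : ∀ {φ} → Occurs p φ → Occurs p (◇ φ)
  □o   : ∀ {φ} → Occurs p φ → Occurs p (□ φ)

Rel : Set → Set₁
Rel W = W → W → Set

Val : Set → Set₁
Val W = W → ℕ → Set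

Sat : (W : Set) → Rel W → Val W → W → Fm → Set
Sat W R V w ⊤ᶠ       = Unit
Sat W R V w (var p)  = V w p
Sat W R V w (¬ᶠ φ)   = ¬ Sat W R V w φ
Sat W R V w (φ ∨ᶠ ψ) = Sat W R V w φ ⊎ Sat W R V w ψ
Sat W R V w (◇ φ)    = Σ W λ v → R w v × Sat W R V v φ
Sat W R V w (□ φ)    = ∀ v → R w v → Sat W R V v φ

data Logic : Set where
  K T K4 S4 : Logic

Reflexive : (W : Set) → Rel W → Set
Reflexive W R = ∀ w → R w w

Transitive : (W : Set) → Rel W → Set
Transitive W R = ∀ u v w → R u v → R v w → R u w

FrameClass : Logic → (W : Set) → Rel W → Set
FrameClass K  W R = Unit
FrameClass T  W R = Reflexive W R
FrameClass K4 W R = Transitive W R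
FrameClass S4 W R = Reflexive W R × Transitive W R

data PLit : Set where
  ⊤ₗ  : PLit
  varₗ : ℕ → PLit
  ◇ₗ  : PLit → PLit
  □ₗ  : PLit → PLit

⟦_⟧ₗ : PLit → Fm
⟦ ⊤ₗ ⟧ₗ     = ⊤ᶠ
⟦ varₗ p ⟧ₗ = var p
⟦ ◇ₗ l ⟧ₗ   = ◇ ⟦ l ⟧ₗ
⟦ □ₗ l ⟧ₗ   = □ ⟦ l ⟧ₗ

⋁ : List Fm → Fm
⋁ []           = ⊥ᶠ
⋁ (φ ∷ [])     = φ
⋁ (φ ∷ ψ ∷ φs) = φ ∨ᶠ ⋁ (ψ ∷ φs)

⋀ : List Fm → Fm
⋀ []           = ⊤ᶠ
⋀ (φ ∷ [])     = φ
⋀ (φ ∷ ψ ∷ φs) = φ ∧ᶠ ⋀ (ψ ∷ φs)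

□^ : ℕ → Fm → Fm
□^ ℕ.zero    φ = φ
□^ (ℕ.suc s) φ = □ (□^ s φ)

-- a clause  □^s (¬λ₁ ∨ … ∨ ¬λₙ ∨ λₙ₊₁ ∨ … ∨ λₙ₊ₘ)
record Clause : Set where
  constructor clause
  field
    boxes : ℕ
    negs  : List PLit
    poss  : List PLit

open Clause public

⟦_⟧c : Clause → Fm
⟦ c ⟧c = □^ (boxes c) (⋁ (map (λ l → ¬ᶠ ⟦ l ⟧ₗ) (negs c) ++ map ⟦_⟧ₗ (poss c)))

⟦_⟧cf : List Clause → Fm
⟦ cs ⟧cf = ⋀ (map ⟦_⟧c cs)

HornClause : Clause → Set
HornClause c = length (poss c) ≤ 1

KromClause : Clause → Set
KromClause c = length (negs c) + length (poss c) ≤ 2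

CoreClause : Clause → Set
CoreClause c = HornClause c × KromClause c

data Lang : Set where
  Bool Horn Krom Core : Lang

ClauseOK : Lang → Clause → Set
ClauseOK Bool c = Unit
ClauseOK Horn c = HornClause c
ClauseOK Krom c = KromClause c
ClauseOK Core c = CoreClause c

InLang : Lang → Fm → Set
InLang Bool φ = Unit
InLang ℓ    φ = Σ (List Clause) λ cs → All (ClauseOK ℓ) cs × ⟦ cs ⟧cf ≡ φ

AgreeOn : {W : Set} → Fm → Val W → Val W → Set
AgreeOn {W} φ V V' = ∀ p → Occurs p φ → ∀ (v : W) → V' v p ⇔ V v p

record Translation (L : Logic) (ℓ₁ ℓ₂ : Lang) : Set₁ where
  field
    tr      : (φ : Fm) → InLang ℓ₁ φ → Fm
    tr-lang : (φ : Fm) (h : InLang ℓ₁ φ) → InLang ℓ₂ (tr φ h)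
    tr-ok   : (φ : Fm) (h : InLang ℓ₁ φ)
              (W : Set) (R : Rel W) (V : Val W) → FrameClass L W R → (w : W) →
              Sat W R V w φ ⇔
              Σ (Val W) (λ V' → AgreeOn φ V V' × Sat W R V' w (tr φ h))

StronglyLessExpressive : Logic → Lang → Lang → Set₁
StronglyLessExpressive L ℓ₁ ℓ₂ = Translation L ℓ₁ ℓ₂ × ¬ Translation L ℓ₂ ℓ₁

-- A model-extending translation of p ∨ q would be a formula ψ such that a
-- valuation satisfies p ∨ q exactly when it extends to one satisfying ψ.  On
-- the one-point reflexive frame, which lies in every frame class considered,
-- Horn formulas are preserved under intersection of valuations.  The
-- valuations {p} and {q} satisfy p ∨ q, so they extend to models A and B of ψ;
-- then A ∩ B satisfies ψ, hence p ∨ q, although it makes neither p nor q true.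
-- Since p ∨ q is a Krom formula and Core ⊆ Horn, this excludes translations
-- from Bool to Horn and from Krom to Core; the converse translations are
-- identities.
module Submission where

open import Defs
open import Data.Product using (_×_; Σ; _,_; proj₁; proj₂)
open import Data.Nat using (ℕ; zero; suc; _≤_; z≤n; s≤s)
open import Data.List using (List; []; _∷_; map; _++_; length)
open import Data.List.Relation.Unary.All as All using (All; []; _∷_)
open import Data.List.Relation.Unary.All.Properties using (map⁺; map⁻)
open import Data.List.Relation.Unary.Any as Any using (Any; here; there)
open import Data.List.Relation.Unary.Any.Properties using (++⁻; ++⁺ˡ; ++⁺ʳ)
  renaming (map⁻ to Any-map⁻; map⁺ to Any-map⁺)
open import Data.Sum as Sum using (_⊎_; inj₁; inj₂)
open import Data.Empty using (⊥-elim)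
open import Data.Unit using (tt) renaming (⊤ to Unit)
open import Function using (id; _∘′_)
open import Relation.Nullary using (¬_)
open import Relation.Binary.PropositionalEquality using (_≡_; refl)
open import Function.Bundles using (_⇔_; mk⇔; Equivalence)
open Equivalence

Sat-agree : ∀ {W} (R : Rel W) {V V' : Val W} (φ : Fm) → AgreeOn φ V V' →
            ∀ w → Sat W R V w φ ⇔ Sat W R V' w φ
Sat-agree R ⊤ᶠ      ag w = mk⇔ id id
Sat-agree R (var p) ag w = mk⇔ (from (ag p here w)) (to (ag p here w))
Sat-agree R (¬ᶠ φ)  ag w =
  let ih = Sat-agree R φ (λ p o → ag p (¬o o)) w in
  mk⇔ (λ ¬s s → ¬s (from ih s)) (λ ¬s s → ¬s (to ih s))
Sat-agree R (φ ∨ᶠ ψ) ag w =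
  let ihφ = Sat-agree R φ (λ p o → ag p (∨l o)) w
      ihψ = Sat-agree R ψ (λ p o → ag p (∨r o)) w in
  mk⇔ (Sum.map (to ihφ) (to ihψ)) (Sum.map (from ihφ) (from ihψ))
Sat-agree R (◇ φ) ag w =
  let ih = Sat-agree R φ (λ p o → ag p (◇o o)) in
  mk⇔ (λ (v , r , s) → v , r , to (ih v) s) (λ (v , r , s) → v , r , from (ih v) s)
Sat-agree R (□ φ) ag w =
  let ih = Sat-agree R φ (λ p o → ag p (□o o)) in
  mk⇔ (λ s v r → to (ih v) (s v r)) (λ s v r → from (ih v) (s v r))

AgreeOn-refl : ∀ {W} (φ : Fm) (V : Val W) → AgreeOn φ V V
AgreeOn-refl φ V p _ v = mk⇔ id id

identityTranslation : (L : Logic) {ℓ₁ ℓ₂ : Lang} →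
                      (∀ φ → InLang ℓ₁ φ → InLang ℓ₂ φ) → Translation L ℓ₁ ℓ₂
identityTranslation L ℓ₁⊆ℓ₂ = record
  { tr      = λ φ _ → φ
  ; tr-lang = ℓ₁⊆ℓ₂
  ; tr-ok   = λ φ _ W R V _ w → mk⇔
      (λ s → V , AgreeOn-refl φ V , s)
      (λ (_ , ag , s) → from (Sat-agree R φ ag w) s)
  }

Core⊆Krom : ∀ φ → InLang Core φ → InLang Krom φ
Core⊆Krom φ (cs , core , e) = cs , All.map proj₂ core , e

Core⊆Horn : ∀ φ → InLang Core φ → InLang Horn φ
Core⊆Horn φ (cs , core , e) = cs , All.map proj₁ core , e

module _ {W : Set} (R : Rel W) (V : Val W) (w : W) where

  private
    _⊩_ : W → Fm → Set
    v ⊩ φ = Sat W R V v φ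

  ⋁-Any : (φs : List Fm) → w ⊩ ⋁ φs ⇔ Any (w ⊩_) φs
  ⋁-Any []           = mk⇔ (λ s → ⊥-elim (s tt)) (λ ())
  ⋁-Any (φ ∷ [])     = mk⇔ here λ { (here s) → s }
  ⋁-Any (φ ∷ ψ ∷ φs) with ⋁-Any (ψ ∷ φs)
  ... | ih = mk⇔ Sum.[ here , there ∘′ to ih ]
                 λ { (here s) → inj₁ s ; (there a) → inj₂ (from ih a) }

  -- ∧ is encoded as ¬(¬φ ∨ ¬ψ), so conjunctions are only recovered up to
  -- double negation.
  ⋀-All : ∀ φs → ¬ ¬ (w ⊩ ⋀ φs) → All (λ φ → ¬ ¬ (w ⊩ φ)) φs
  ⋀-All []           _  = []
  ⋀-All (φ ∷ [])     nn = nn ∷ []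
  ⋀-All (φ ∷ ψ ∷ φs) nn =
    (λ ¬s → nn (λ s → s (inj₁ ¬s))) ∷ ⋀-All (ψ ∷ φs) (λ ¬s → nn (λ s → s (inj₂ ¬s)))

  All-⋀ : ∀ φs → All (λ φ → ¬ ¬ (w ⊩ φ)) φs → ¬ ¬ (w ⊩ ⋀ φs)
  All-⋀ []           _          ¬s = ¬s tt
  All-⋀ (φ ∷ [])     (nn ∷ [])  = nn
  All-⋀ (φ ∷ ψ ∷ φs) (nn ∷ nns) ¬s = ¬s Sum.[ nn , All-⋀ (ψ ∷ φs) nns ]

  ClauseBody : List PLit → List PLit → Set
  ClauseBody ns ps = Any (λ l → ¬ (w ⊩ ⟦ l ⟧ₗ)) ns ⊎ Any (λ l → w ⊩ ⟦ l ⟧ₗ) ps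

  ⋁-clauseBody : ∀ ns ps →
    w ⊩ ⋁ (map (λ l → ¬ᶠ ⟦ l ⟧ₗ) ns ++ map ⟦_⟧ₗ ps) ⇔ ClauseBody ns ps
  ⋁-clauseBody ns ps = mk⇔
    (λ s → Sum.map Any-map⁻ Any-map⁻ (++⁻ negated (to (⋁-Any (negated ++ map ⟦_⟧ₗ ps)) s)))
    (λ b → from (⋁-Any (negated ++ map ⟦_⟧ₗ ps))
      (Sum.[ (λ a → ++⁺ˡ (Any-map⁺ a)) , (λ a → ++⁺ʳ negated (Any-map⁺ a)) ] b))
    where
    negated : List Fm
    negated = map (λ l → ¬ᶠ ⟦ l ⟧ₗ) ns

_⊆ᵛ_ : ∀ {W} → Val W → Val W → Set
V ⊆ᵛ V' = ∀ v p → V v p → V' v p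

_∩ᵛ_ : ∀ {W} → Val W → Val W → Val W
(A ∩ᵛ B) v p = A v p × B v p

∩ᵛ-⊆ˡ : ∀ {W} (A B : Val W) → (A ∩ᵛ B) ⊆ᵛ A
∩ᵛ-⊆ˡ A B _ _ = proj₁

∩ᵛ-⊆ʳ : ∀ {W} (A B : Val W) → (A ∩ᵛ B) ⊆ᵛ B
∩ᵛ-⊆ʳ A B _ _ = proj₂

PLit-mono : ∀ {W} (R : Rel W) {V V' : Val W} → V ⊆ᵛ V' →
            ∀ l w → Sat W R V w ⟦ l ⟧ₗ → Sat W R V' w ⟦ l ⟧ₗ
PLit-mono R V⊆V' ⊤ₗ       w s           = s
PLit-mono R V⊆V' (varₗ p) w s           = V⊆V' w p s
PLit-mono R V⊆V' (◇ₗ l)   w (v , r , s) = v , r , PLit-mono R V⊆V' l v s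
PLit-mono R V⊆V' (□ₗ l)   w s           = λ v r → PLit-mono R V⊆V' l v (s v r)

total : Rel Unit
total _ _ = Unit

total-inEveryClass : (L : Logic) → FrameClass L Unit total
total-inEveryClass K  = tt
total-inEveryClass T  = λ _ → tt
total-inEveryClass K4 = λ _ _ _ _ _ → tt
total-inEveryClass S4 = (λ _ → tt) , (λ _ _ _ _ _ → tt)

infix 4 _⊨_

_⊨_ : Val Unit → Fm → Set
V ⊨ φ = Sat Unit total V tt φ

□^-point : ∀ (V : Val Unit) s φ → V ⊨ □^ s φ ⇔ V ⊨ φ
□^-point V zero    φ = mk⇔ id id
□^-point V (suc s) φ = mk⇔ (λ b → to (□^-point V s φ) (b tt tt))
                          (λ a _ _ → from (□^-point V s φ) a)

module _ (A B : Val Unit) where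

  -- The ◇ case is where a single world is needed: both witnesses coincide.
  PLit-∩ : ∀ l w → Sat Unit total A w ⟦ l ⟧ₗ → Sat Unit total B w ⟦ l ⟧ₗ →
           Sat Unit total (A ∩ᵛ B) w ⟦ l ⟧ₗ
  PLit-∩ ⊤ₗ       w a            b            = tt
  PLit-∩ (varₗ p) w a            b            = a , b
  PLit-∩ (◇ₗ l)   w (tt , r , a) (tt , _ , b) = tt , r , PLit-∩ l tt a b
  PLit-∩ (□ₗ l)   w a            b            = λ v r → PLit-∩ l v (a v r) (b v r)

  private
    Body : Val Unit → List PLit → List PLit → Set
    Body V = ClauseBody total V tt

  hornBody-∩ : ∀ ns ps → length ps ≤ 1 →
               Body A ns ps → Body B ns ps → Body (A ∩ᵛ B) ns ps
  hornBody-∩ ns ps          _        (inj₁ a)        _               =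
    inj₁ (Any.map (λ {l} ¬a c → ¬a (PLit-mono total (∩ᵛ-⊆ˡ A B) l tt c)) a)
  hornBody-∩ ns ps          _        (inj₂ _)        (inj₁ b)        =
    inj₁ (Any.map (λ {l} ¬b c → ¬b (PLit-mono total (∩ᵛ-⊆ʳ A B) l tt c)) b)
  hornBody-∩ ns (l ∷ [])    _        (inj₂ (here a)) (inj₂ (here b)) =
    inj₂ (here (PLit-∩ l tt a b))
  hornBody-∩ ns (l ∷ _ ∷ _) (s≤s ()) (inj₂ _)        (inj₂ _)

  hornClause-∩ : ∀ c → HornClause c → A ⊨ ⟦ c ⟧c → B ⊨ ⟦ c ⟧c → (A ∩ᵛ B) ⊨ ⟦ c ⟧c
  hornClause-∩ (clause s ns ps) horn a b =
    from (□^-point (A ∩ᵛ B) s _) (from (⋁-clauseBody total (A ∩ᵛ B) tt ns ps)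
      (hornBody-∩ ns ps horn (body A a) (body B b)))
    where
    body : ∀ V → V ⊨ ⟦ clause s ns ps ⟧c → Body V ns ps
    body V v = to (⋁-clauseBody total V tt ns ps) (to (□^-point V s _) v)

  horn-∩ : ∀ cs → All HornClause cs →
           A ⊨ ⟦ cs ⟧cf → B ⊨ ⟦ cs ⟧cf → ¬ ¬ ((A ∩ᵛ B) ⊨ ⟦ cs ⟧cf)
  horn-∩ cs horn a b =
    All-⋀ total (A ∩ᵛ B) tt (map ⟦_⟧c cs)
      (map⁺ (All.zipWith (λ {c} → clause-∩ c) (horn , All.zip (clauses A a , clauses B b))))
    where
    clauses : ∀ V → V ⊨ ⟦ cs ⟧cf → All (λ c → ¬ ¬ (V ⊨ ⟦ c ⟧c)) cs
    clauses V v = map⁻ (⋀-All total V tt (map ⟦_⟧c cs) (λ ¬v → ¬v v))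

    clause-∩ : ∀ c → HornClause c × (¬ ¬ (A ⊨ ⟦ c ⟧c) × ¬ ¬ (B ⊨ ⟦ c ⟧c)) →
               ¬ ¬ ((A ∩ᵛ B) ⊨ ⟦ c ⟧c)
    clause-∩ c (h , na , nb) ¬c = na λ a → nb λ b → ¬c (hornClause-∩ c h a b)

ExtensionEquivalent : Logic → Fm → Fm → Set₁
ExtensionEquivalent L φ ψ =
  (W : Set) (R : Rel W) (V : Val W) → FrameClass L W R → (w : W) →
  Sat W R V w φ ⇔ Σ (Val W) (λ V' → AgreeOn φ V V' × Sat W R V' w ψ)

p∨q : Fm
p∨q = var 0 ∨ᶠ var 1

p∨q-Krom : InLang Krom p∨q
p∨q-Krom = clause 0 [] (varₗ 0 ∷ varₗ 1 ∷ []) ∷ [] , s≤s (s≤s z≤n) ∷ [] , refl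

only : ℕ → Val Unit
only p _ q = q ≡ p

extensions-∩-⊭p∨q : ∀ {A B} → AgreeOn p∨q (only 0) A → AgreeOn p∨q (only 1) B →
                    ¬ (A ∩ᵛ B) ⊨ p∨q
extensions-∩-⊭p∨q A≈0 B≈1 (inj₁ (_ , B0)) with () ← to (B≈1 0 (∨l here) tt) B0
extensions-∩-⊭p∨q A≈0 B≈1 (inj₂ (A1 , _)) with () ← to (A≈0 1 (∨r here) tt) A1

p∨q-notHorn : ∀ L ψ → InLang Horn ψ → ¬ ExtensionEquivalent L p∨q ψ
p∨q-notHorn L ψ (cs , horn , refl) equiv =
  let A , A≈0 , A⊨ψ = to (onPoint (only 0)) (inj₁ refl)
      B , B≈1 , B⊨ψ = to (onPoint (only 1)) (inj₂ refl)
  in horn-∩ A B cs horn A⊨ψ B⊨ψ λ A∩B⊨ψ →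
       extensions-∩-⊭p∨q A≈0 B≈1
         (from (onPoint (A ∩ᵛ B)) (A ∩ᵛ B , AgreeOn-refl p∨q (A ∩ᵛ B) , A∩B⊨ψ))
  where
  onPoint : ∀ V → V ⊨ p∨q ⇔ Σ (Val Unit) (λ V' → AgreeOn p∨q V V' × V' ⊨ ⟦ cs ⟧cf)
  onPoint V = equiv Unit total V (total-inEveryClass L) tt

theorem3p2 : (L : Logic) →
    StronglyLessExpressive L Horn Bool × StronglyLessExpressive L Core Krom
theorem3p2 L =
  (identityTranslation L (λ _ _ → tt) , λ t →
     p∨q-notHorn L _ (tr-lang t p∨q tt) (tr-ok t p∨q tt)) ,
  (identityTranslation L Core⊆Krom , λ t →
     p∨q-notHorn L _ (Core⊆Horn _ (tr-lang t p∨q p∨q-Krom)) (tr-ok t p∨q p∨q-Krom))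
  where open Translation
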